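{- Let $M$ be a finite LTS equipped with a concurrency relation on actions $\smile$, and $B\subseteq\mathit{Act}$. Every finite path of $M$ can be extended to a path of $M$ that satisfies $B$-justness of actions (i.e., $B$-justness of actions is feasible).
   Context: LTS $M=(S,s_{init},\mathit{Act},\mathit{Trans})$ with $S$ and $\mathit{Act}$ finite. Paths: alternating sequences $s_0t_1s_1\dots$ starting in a state, infinite or ending in a state, consecutive; a path $\pi'$ extends a finite path $\pi$ if $\pi$ is a prefix of $\pi'$. An action occurs on a path if a transition on it carries that label. An action is enabled in $s$ if a transition with that label leaves $s$. $\overline{B}=\mathit{Act}\setminus B$. A relation $\smile\subseteq\mathit{Act}\times\mathit{Act}$ is a concurrency relation on actions iff it is irreflexive and, for all $a$, whenever $a$ is enabled in $s$ and $\pi$ is a path from $s$ to $s'$ such that $a\smile b$ for all actions $b$ occurring in $\pi$, then $a$ is enabled in $s'$; $\not\smile$ denotes its complement. A path $\pi$ satisfies $B$-justness of actions iff for each $a\in\overline{B}$ enabled in some state $s$ of $\pi$, some action $a'$ with $a\not\smile a'$ occurs in the suffix of $\pi$ starting at $s$. -}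

module Defs where

open import Data.Nat using (ℕ; suc; _<_; _≤_)
open import Data.Fin using (Fin)
open import Data.Fin.Subset using (Subset; _∉_)
open import Data.Bool using (Bool; true)
open import Data.Maybe using (Maybe; just; nothing)
open import Data.Unit using (⊤)
open import Data.Product using (Σ; ∃; _×_)
open import Relation.Binary.PropositionalEquality using (_≡_)
open import Relation.Nullary using (¬_)

record LTS : Set where
  field
    nS    : ℕ
    nA    : ℕ
    sinit : Fin nS
    trans : Fin nS → Fin nA → Fin nS → Bool

module _ (M : LTS) where
  open LTS M

  Trans : Fin nS → Fin nA → Fin nS → Set
  Trans s a s' = trans s a s' ≡ true

  Enabled : Fin nA → Fin nS → Set
  Enabled a s = ∃ λ s' → Trans s a s'

  -- Bounds for positions of a path of length len (nothing = infinite).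
  -- Transition positions: i < len.  State positions: i ≤ len.
  _<ₗ_ : ℕ → Maybe ℕ → Set
  i <ₗ just k  = i < k
  i <ₗ nothing = ⊤

  _≤ₗ_ : ℕ → Maybe ℕ → Set
  i ≤ₗ just k  = i ≤ k
  i ≤ₗ nothing = ⊤

  -- A path s₀ t₁ s₁ t₂ …: the i-th transition is (st i, act i, st (suc i)).
  -- len = just k : finite path with k transitions (ending in st k);
  -- len = nothing : infinite path.  Values of st/act beyond the
  -- length are irrelevant.
  record Path : Set where
    field
      len   : Maybe ℕ
      st    : ℕ → Fin nS
      act   : ℕ → Fin nA
      valid : ∀ i → i <ₗ len → Trans (st i) (act i) (st (suc i))
  open Path public

  Extends : Path → Path → Set
  Extends π π' = Σ ℕ λ k → len π ≡ just k × k ≤ₗ len π'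
                 × (∀ i → i ≤ k → st π i ≡ st π' i)
                 × (∀ i → i < k → act π i ≡ act π' i)

  IsConcurrency : (Fin nA → Fin nA → Bool) → Set
  IsConcurrency conc =
    (∀ a → ¬ (conc a a ≡ true))
    × (∀ a (π : Path) k → len π ≡ just k
        → Enabled a (st π 0)
        → (∀ i → i < k → conc a (act π i) ≡ true)
        → Enabled a (st π k))

  Just : (Fin nA → Fin nA → Bool) → Subset nA → Path → Set
  Just conc B π =
    ∀ a i → a ∉ B → i ≤ₗ len π → Enabled a (st π i)
      → Σ ℕ λ j → i ≤ j × j <ₗ len π × ¬ (conc a (act π j) ≡ true)

{-# OPTIONS --safe #-}
module Submission where

-- Extend π by a round-robin run from its last state: at step n take action
-- n mod |Act| if it is enabled, otherwise any enabled action, and stop only in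
-- a deadlock.  If an action a is enabled at some position and every later
-- action is concurrent with a, then a is still enabled at every later
-- position.  A run ending in a deadlock is therefore just, and in an infinite
-- run a is eventually preferred while enabled, hence taken, and ⌣ is
-- irreflexive.  Whether the run deadlocks is decidable: its configurations
-- (state, preferred action) range over a finite set, so everything it ever
-- visits is visited within the first |S|·|Act| + 1 steps.

open import Defs hiding (_<ₗ_; _≤ₗ_)
open import Data.Nat using (ℕ; zero; suc; _+_; _*_; _∸_; _<_; _≤_; _<?_; NonZero; z<s; s≤s⁻¹)
open import Data.Nat.Properties
  using (≤-refl; ≤-trans; <-trans; <⇒≤; ≮⇒≥; m≤n⇒m<n∨m≡n; m≤n⇒∃[o]m+o≡n; m∸n+n≡m; m≤m+n; m≤n+m; m≤m*n;
         m≤n+m∸n; m≤n+o⇒m∸n≤o; +-identityʳ; +-suc; +-monoʳ-≤; +-monoʳ-<; +-monoˡ-<; +-cancelˡ-<;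
         n<1+n; m<n⇒m<1+n; nonZero?; anyUpTo?)
open import Data.Nat.DivMod using (_%_; _/_; _mod_; m≡m%n+[m/n]*n; [m+kn]%n≡m%n; m<n⇒m%n≡m)
open import Data.Nat.GeneralisedArithmetic using (fold)
open import Data.Fin using (Fin; toℕ)
open import Data.Fin.Properties
  using (any?; all?; pigeonhole; toℕ<n; toℕ-injective; toℕ-fromℕ<; nonZeroIndex; *↔×)
open import Data.Fin.Subset using (Subset)
open import Data.Bool using (Bool; true; false)
open import Data.Bool.Properties using (_≟_; not-¬; ¬-not)
open import Data.Maybe using (Maybe; just; nothing; map)
open import Data.Product using (Σ; ∃-syntax; _×_; _,_; proj₁; proj₂)
open import Data.Sum using (_⊎_; inj₁; inj₂)
open import Data.Unit using (tt)
open import Function using (_∘_; _↣_; Injection)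
open import Function.Properties.Inverse using (↔⇒↣; ↔-sym)
open import Relation.Nullary using (¬_; Dec; yes; no; contradiction; ¬?)
open import Relation.Binary.PropositionalEquality
  using (_≡_; refl; sym; trans; cong; subst; module ≡-Reasoning)

[1+m%n]%n≡[1+m]%n : ∀ m n .{{_ : NonZero n}} → suc (m % n) % n ≡ suc m % n
[1+m%n]%n≡[1+m]%n m n = begin
  suc (m % n) % n              ≡⟨ [m+kn]%n≡m%n (suc (m % n)) (m / n) n ⟨
  suc (m % n + m / n * n) % n  ≡⟨ cong (λ x → suc x % n) (m≡m%n+[m/n]*n m n) ⟨
  suc m % n                    ∎
  where open ≡-Reasoning

[i+kn]%n≡i : ∀ {n} .{{_ : NonZero n}} (i : Fin n) k → (toℕ i + k * n) % n ≡ toℕ i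
[i+kn]%n≡i {n} i k = trans ([m+kn]%n≡m%n (toℕ i) k n) (m<n⇒m%n≡m (toℕ<n i))

module _ {P : ℕ → Set} (P? : ∀ n → Dec (P n)) where

  leastUpTo : ∀ v → (∃[ n ] n < v × P n × (∀ {i} → i < n → ¬ P i)) ⊎ (∀ {n} → n < v → ¬ P n)
  leastUpTo zero = inj₂ λ ()
  leastUpTo (suc v) with leastUpTo v
  ... | inj₁ (n , n<v , Pn , below) = inj₁ (n , m<n⇒m<1+n n<v , Pn , below)
  ... | inj₂ none with P? v
  ...   | yes Pv = inj₁ (v , n<1+n v , Pv , none)
  ...   | no ¬Pv = inj₂ λ n<1+v → below-or-at (m≤n⇒m<n∨m≡n (s≤s⁻¹ n<1+v))
    where
    below-or-at : ∀ {n} → n < v ⊎ n ≡ v → ¬ P n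
    below-or-at (inj₁ n<v) = none n<v
    below-or-at (inj₂ refl) = ¬Pv

module _ {A : Set} (f : A → A) (x : A) where

  fold-repeats⇒bounded : ∀ {p q} → p < q → fold x f p ≡ fold x f q →
                         ∀ n → ∃[ m ] m < q × fold x f n ≡ fold x f m
  fold-repeats⇒bounded p<q repeat zero = 0 , ≤-trans z<s p<q , refl
  fold-repeats⇒bounded {p} p<q repeat (suc n) with fold-repeats⇒bounded p<q repeat n
  ... | m , m<q , same with m≤n⇒m<n∨m≡n m<q
  ...   | inj₁ 1+m<q = suc m , 1+m<q , cong f same
  ...   | inj₂ refl = p , p<q , trans (cong f same) (sym repeat)

  fold-bounded : ∀ {N} → A ↣ Fin N → ∀ n → ∃[ m ] m < suc N × fold x f n ≡ fold x f m
  fold-bounded {N} ι n with pigeonhole (n<1+n N) (Injection.to ι ∘ fold x f ∘ toℕ)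
  ... | p , q , p<q , same =
    let m , m<q , eq = fold-repeats⇒bounded p<q (Injection.injective ι same) n
    in m , <-trans m<q (toℕ<n q) , eq

splice : {A : Set} → ℕ → (ℕ → A) → (ℕ → A) → ℕ → A
splice zero f g i = g i
splice (suc k) f g zero = f zero
splice (suc k) f g (suc i) = splice k (f ∘ suc) g i

module _ {A : Set} where

  splice-< : ∀ {k i} {f g : ℕ → A} → i < k → splice k f g i ≡ f i
  splice-< {suc k} {zero} _ = refl
  splice-< {suc k} {suc i} i<k = splice-< {k} (s≤s⁻¹ i<k)

  splice-+ : ∀ k m {f g : ℕ → A} → splice k f g (k + m) ≡ g m
  splice-+ zero m = refl
  splice-+ (suc k) m = splice-+ k m

data Split (k : ℕ) : ℕ → Set where
  before : ∀ {i} → i < k → Split k i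
  after  : ∀ m → Split k (k + m)

split : ∀ k i → Split k i
split k i with i <? k
... | yes i<k = before i<k
... | no i≮k with m≤n⇒∃[o]m+o≡n (≮⇒≥ i≮k)
...   | m , refl = after m

module _ (M : LTS) where
  open LTS M using (nS; nA)

  _<ₗ_ : ℕ → Maybe ℕ → Set
  _<ₗ_ = Defs._<ₗ_ M

  _≤ₗ_ : ℕ → Maybe ℕ → Set
  _≤ₗ_ = Defs._≤ₗ_ M

  _+ₗ_ : ℕ → Maybe ℕ → Maybe ℕ
  k +ₗ L = map (k +_) L

  infix 4 _<ₗ_ _≤ₗ_
  infixl 6 _+ₗ_

  <-≤ₗ-trans : ∀ {i m} L → i < m → m ≤ₗ L → i <ₗ L
  <-≤ₗ-trans (just l) i<m m≤l = ≤-trans i<m m≤l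
  <-≤ₗ-trans nothing _ _ = tt

  m≤ₗm+ₗL : ∀ m L → m ≤ₗ m +ₗ L
  m≤ₗm+ₗL m (just l) = m≤m+n m l
  m≤ₗm+ₗL m nothing = tt

  +-monoʳ-≤ₗ : ∀ k {m} L → m ≤ₗ L → k + m ≤ₗ k +ₗ L
  +-monoʳ-≤ₗ k (just l) m≤l = +-monoʳ-≤ k m≤l
  +-monoʳ-≤ₗ k nothing _ = tt

  +-monoʳ-<ₗ : ∀ k {m} L → m <ₗ L → k + m <ₗ k +ₗ L
  +-monoʳ-<ₗ k (just l) m<l = +-monoʳ-< k m<l
  +-monoʳ-<ₗ k nothing _ = tt

  +-cancelˡ-<ₗ : ∀ k {m} L → k + m <ₗ k +ₗ L → m <ₗ L
  +-cancelˡ-<ₗ k (just l) lt = +-cancelˡ-< k _ l lt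
  +-cancelˡ-<ₗ k nothing _ = tt

  m≤ₗn+ₗL⇒m∸n≤ₗL : ∀ m n L → m ≤ₗ n +ₗ L → m ∸ n ≤ₗ L
  m≤ₗn+ₗL⇒m∸n≤ₗL m n (just l) le = m≤n+o⇒m∸n≤o m n le
  m≤ₗn+ₗL⇒m∸n≤ₗL m n nothing _ = tt

  segment : (ρ : Path M) → ∀ d i → d + i ≤ₗ len ρ → Path M
  segment ρ d i bound = record
    { len = just d
    ; st = λ t → st ρ (t + i)
    ; act = λ t → act ρ (t + i)
    ; valid = λ t t<d → valid ρ (t + i) (<-≤ₗ-trans (len ρ) (+-monoˡ-< i t<d) bound)
    }

  Served : Path M → Fin nA → ℕ → Set
  Served ρ a m = Enabled M a (st ρ m) → m <ₗ len ρ × act ρ m ≡ a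

  -- At the last position i of a finite path the only choice is m = i, so
  -- finite fair paths end in deadlocks.
  Fair : Path M → Set
  Fair ρ = ∀ a i → i ≤ₗ len ρ → ∃[ m ] i ≤ m × m ≤ₗ len ρ × Served ρ a m

  module _ (conc : Fin nA → Fin nA → Bool) (isC : IsConcurrency M conc) where

    enabled-until-interference :
      (ρ : Path M) → ∀ {a} d i → d + i ≤ₗ len ρ → Enabled M a (st ρ i) →
      (∃[ t ] t < d × conc a (act ρ (t + i)) ≡ false) ⊎ Enabled M a (st ρ (d + i))
    enabled-until-interference ρ {a} d i bound en
      with anyUpTo? (λ t → conc a (act ρ (t + i)) ≟ false) d
    ... | yes interference = inj₁ interference
    ... | no none = inj₂ (proj₂ isC a (segment ρ d i bound) d refl en
                            λ t t<d → ¬-not λ independent → none (t , t<d , independent))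

    Fair⇒Just : ∀ B ρ → Fair ρ → Just M conc B ρ
    Fair⇒Just B ρ fair a i _ i≤len en with fair a i i≤len
    ... | m , i≤m , m≤len , served with m ∸ i | m∸n+n≡m i≤m
    ...   | d | refl with enabled-until-interference ρ d i m≤len en
    ...     | inj₁ (t , t<d , independent) =
      t + i , m≤n+m i t , <-≤ₗ-trans (len ρ) (+-monoˡ-< i t<d) m≤len , not-¬ independent
    ...     | inj₂ still-enabled =
      let m<len , taken = served still-enabled
      in d + i , m≤n+m i d , m<len , λ c → proj₁ isC a (subst (λ b → conc a b ≡ true) taken c)

  Extends-refl : ∀ (π : Path M) {k} → len π ≡ just k → Extends M π π
  Extends-refl π {k} len-π =
    k , len-π , subst (k ≤ₗ_) (sym len-π) ≤-refl , (λ _ _ → refl) , (λ _ _ → refl)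

  module _ (π : Path M) {k} (len-π : len π ≡ just k) (τ : Path M) (joins : st τ 0 ≡ st π k) where

    private
      st-≤ : ∀ {i} → i ≤ k → splice k (st π) (st τ) i ≡ st π i
      st-≤ i≤k with m≤n⇒m<n∨m≡n i≤k
      ... | inj₁ i<k = splice-< i<k
      ... | inj₂ refl = begin
        splice k (st π) (st τ) k        ≡⟨ cong (splice k (st π) (st τ)) (+-identityʳ k) ⟨
        splice k (st π) (st τ) (k + 0)  ≡⟨ splice-+ k 0 ⟩
        st τ 0                          ≡⟨ joins ⟩
        st π k                          ∎
        where open ≡-Reasoning

      st-+suc : ∀ m → splice k (st π) (st τ) (suc (k + m)) ≡ st τ (suc m)
      st-+suc m = trans (cong (splice k (st π) (st τ)) (sym (+-suc k m))) (splice-+ k (suc m))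

    append-valid : ∀ i → i <ₗ k +ₗ len τ →
      Trans M (splice k (st π) (st τ) i) (splice k (act π) (act τ) i) (splice k (st π) (st τ) (suc i))
    append-valid i i<len with split k i
    ... | before i<k
      rewrite st-≤ (<⇒≤ i<k) | splice-< {f = act π} {g = act τ} i<k | st-≤ i<k
      = valid π i (subst (i <ₗ_) (sym len-π) i<k)
    ... | after m
      rewrite splice-+ k m {st π} {st τ} | splice-+ k m {act π} {act τ} | st-+suc m
      = valid τ m (+-cancelˡ-<ₗ k (len τ) i<len)

    append : Path M
    append = record
      { len = k +ₗ len τ
      ; st = splice k (st π) (st τ)
      ; act = splice k (act π) (act τ)
      ; valid = append-valid
      }

    append-extends : Extends M π append
    append-extends =
      k , len-π , m≤ₗm+ₗL k (len τ) , (λ i i≤k → sym (st-≤ i≤k)) , λ i i<k → sym (splice-< i<k)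

    append-Fair : Fair τ → Fair append
    append-Fair fair a i i≤len with fair a (i ∸ k) (m≤ₗn+ₗL⇒m∸n≤ₗL i k (len τ) i≤len)
    ... | m , i∸k≤m , m≤len , served =
      k + m , ≤-trans (m≤n+m∸n i k) (+-monoʳ-≤ k i∸k≤m) , +-monoʳ-≤ₗ k (len τ) m≤len ,
      λ en → let m<len , taken = served (subst (Enabled M a) (splice-+ k m) en)
             in +-monoʳ-<ₗ k (len τ) m<len , trans (splice-+ k m) taken

  enabled? : ∀ a s → Dec (Enabled M a s)
  enabled? a s = any? λ s′ → LTS.trans M s a s′ ≟ true

  Deadlock : Fin nS → Set
  Deadlock s = ∀ a → ¬ Enabled M a s

  deadlock? : ∀ s → Dec (Deadlock s)
  deadlock? s = all? λ a → ¬? (enabled? a s)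

  -- The last clause is junk: runs stop at deadlocks.
  move : Fin nA → Fin nS → Fin nA × Fin nS
  move r s with enabled? r s
  ... | yes (s′ , _) = r , s′
  ... | no _ with any? (λ a → enabled? a s)
  ...   | yes (a , s′ , _) = a , s′
  ...   | no _ = r , s

  move-step : ∀ r s → ¬ Deadlock s → Trans M s (proj₁ (move r s)) (proj₂ (move r s))
  move-step r s live with enabled? r s
  ... | yes (_ , t) = t
  ... | no _ with any? (λ a → enabled? a s)
  ...   | yes (_ , _ , t) = t
  ...   | no stuck = contradiction (λ a en → stuck (a , en)) live

  move-prefers : ∀ {r s} → Enabled M r s → proj₁ (move r s) ≡ r
  move-prefers {r} {s} en with enabled? r s
  ... | yes _ = refl
  ... | no ¬en = contradiction en ¬en

  module RoundRobin {{_ : NonZero nA}} (s₀ : Fin nS) where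

    Config : Set
    Config = Fin nS × Fin nA

    Config↣Fin : Config ↣ Fin (nS * nA)
    Config↣Fin = ↔⇒↣ (↔-sym *↔×)

    advance : Config → Config
    advance (s , r) = proj₂ (move r s) , suc (toℕ r) mod nA

    run : ℕ → Config
    run = fold (s₀ , 0 mod nA) advance

    state : ℕ → Fin nS
    state n = proj₁ (run n)

    action : ℕ → Fin nA
    action n = proj₁ (move (proj₂ (run n)) (state n))

    run-phase : ∀ n → toℕ (proj₂ (run n)) ≡ n % nA
    run-phase zero = toℕ-fromℕ< _
    run-phase (suc n) = begin
      toℕ (suc (toℕ (proj₂ (run n))) mod nA)  ≡⟨ toℕ-fromℕ< _ ⟩
      suc (toℕ (proj₂ (run n))) % nA          ≡⟨ cong (λ x → suc x % nA) (run-phase n) ⟩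
      suc (n % nA) % nA                       ≡⟨ [1+m%n]%n≡[1+m]%n n nA ⟩
      suc n % nA                              ∎
      where open ≡-Reasoning

    run-prefers : ∀ a k → proj₂ (run (toℕ a + k * nA)) ≡ a
    run-prefers a k = toℕ-injective (trans (run-phase (toℕ a + k * nA)) ([i+kn]%n≡i a k))

    runPath : (L : Maybe ℕ) → (∀ i → i <ₗ L → ¬ Deadlock (state i)) → Path M
    runPath L live = record
      { len = L
      ; st = state
      ; act = action
      ; valid = λ i i<L → move-step (proj₂ (run i)) (state i) (live i i<L)
      }

    roundRobin : ∃[ τ ] st τ 0 ≡ s₀ × Fair τ
    roundRobin with leastUpTo (deadlock? ∘ state) (suc (nS * nA))
    ... | inj₁ (m , _ , dead , live) =
      runPath (just m) (λ _ → live) , refl ,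
      λ a i i≤m → m , i≤m , ≤-refl , λ en → contradiction en (dead a)
    ... | inj₂ none = runPath nothing (λ i _ → live i) , refl , fair
      where
      live : ∀ i → ¬ Deadlock (state i)
      live i = let m , m<N , same = fold-bounded advance (s₀ , 0 mod nA) Config↣Fin i
               in subst (¬_ ∘ Deadlock ∘ proj₁) (sym same) (none m<N)

      fair : Fair (runPath nothing (λ i _ → live i))
      fair a i _ =
        m , ≤-trans (m≤m*n i nA) (m≤n+m (i * nA) (toℕ a)) , tt ,
        λ en → tt , trans (cong (λ r → proj₁ (move r (state m))) (run-prefers a i)) (move-prefers en)
        where
        m : ℕ
        m = toℕ a + i * nA

  fair-extension : ∀ (π : Path M) {k} → len π ≡ just k → ∃[ π′ ] Extends M π π′ × Fair π′
  fair-extension π {k} len-π with nonZero? nA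
  ... | no nA≡0 = π , Extends-refl π len-π , λ a → contradiction (nonZeroIndex a) nA≡0
  ... | yes nA≢0 =
    let τ , joins , fair = RoundRobin.roundRobin {{nA≢0}} (st π k)
    in append π len-π τ joins , append-extends π len-π τ joins , append-Fair π len-π τ joins fair

proposition39 : (M : LTS)
    → (conc : Fin (LTS.nA M) → Fin (LTS.nA M) → Bool)
    → IsConcurrency M conc
    → (B : Subset (LTS.nA M))
    → (π : Path M) → (k : ℕ) → len π ≡ just k
    → Σ (Path M) λ π' → Extends M π π' × Just M conc B π'
proposition39 M conc isC B π k len-π =
  let π′ , extends , fair = fair-extension M π len-π
  in π′ , extends , Fair⇒Just M conc isC B π′ fair
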